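{- Let $m$ and $\Delta<0$ be numbers such that the ball $[m,\Delta]$ is a number and is balanced. Then $[m,\Delta]=m$.
   Context: Games are short normal-play combinatorial games with the usual disjunctive sum $+$, order and equality $=$. A number is a game whose options are numbers and whose Left options are all strictly less than its Right options. For numbers $m$ and $\Delta$, the ball $[m,\Delta]$ is the game $\{x\mid y\}$ where $x$ and $y$ are the canonical forms of $m+\Delta$ and $m-\Delta$ respectively ($m$ is the midpoint, $\Delta$ the radius). A ball $[m,\Delta]$ is balanced if $[m,\Delta]+[m,\Delta]=m+m$. -}

module Defs where

open import Data.Nat using (ℕ) renaming (_+_ to _+ℕ_)
open import Data.Fin using (Fin; splitAt)
open import Data.Sum using ([_,_])
open import Data.Product using (_×_)
open import Relation.Nullary using (¬_)
open import Relation.Binary.PropositionalEquality using (_≢_)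

data Game : Set where
  mk : (nl : ℕ) → (Fin nl → Game) → (nr : ℕ) → (Fin nr → Game) → Game

nL : Game → ℕ
nL (mk nl _ _ _) = nl

nR : Game → ℕ
nR (mk _ _ nr _) = nr

leftOpt : (G : Game) → Fin (nL G) → Game
leftOpt (mk _ L _ _) = L

rightOpt : (G : Game) → Fin (nR G) → Game
rightOpt (mk _ _ _ R) = R

⟨_∣_⟩ : Game → Game → Game
⟨ x ∣ y ⟩ = mk 1 (λ _ → x) 1 (λ _ → y)

0G : Game
0G = mk 0 (λ ()) 0 (λ ())

_≤G_ : Game → Game → Set
mk nl L nr R ≤G mk ml L' mr R' =
  ((i : Fin nl) → ¬ (mk ml L' mr R' ≤G L i)) ×
  ((j : Fin mr) → ¬ (R' j ≤G mk nl L nr R))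

_≈G_ : Game → Game → Set
G ≈G H = (G ≤G H) × (H ≤G G)

_<G_ : Game → Game → Set
G <G H = (G ≤G H) × ¬ (H ≤G G)

_+G_ : Game → Game → Game
mk nl L nr R +G mk ml L' mr R' =
  mk (nl +ℕ ml)
     (λ k → [ (λ i → L i +G mk ml L' mr R') , (λ j → mk nl L nr R +G L' j) ] (splitAt nl k))
     (nr +ℕ mr)
     (λ k → [ (λ i → R i +G mk ml L' mr R') , (λ j → mk nl L nr R +G R' j) ] (splitAt nr k))

-G_ : Game → Game
-G mk nl L nr R = mk nr (λ j → -G R j) nl (λ i → -G L i)

_-G_ : Game → Game → Game
G -G H = G +G (-G H)

IsNumber : Game → Set
IsNumber (mk nl L nr R) =
  ((i : Fin nl) → IsNumber (L i)) ×
  ((j : Fin nr) → IsNumber (R j)) ×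
  ((i : Fin nl) (j : Fin nr) → L i <G R j)

IsCanonical : Game → Set
IsCanonical (mk nl L nr R) =
  ((i : Fin nl) → IsCanonical (L i)) ×
  ((j : Fin nr) → IsCanonical (R j)) ×
  ((i i' : Fin nl) → i ≢ i' → ¬ (L i ≤G L i')) ×
  ((j j' : Fin nr) → j ≢ j' → ¬ (R j' ≤G R j)) ×
  ((i : Fin nl) (k : Fin (nR (L i))) → ¬ (rightOpt (L i) k ≤G mk nl L nr R)) ×
  ((j : Fin nr) (k : Fin (nL (R j))) → ¬ (mk nl L nr R ≤G leftOpt (R j) k))

-- The ball [m, Δ] = { x | y } where x, y are THE canonical forms of m+Δ and m−Δ
-- (canonical forms are unique, so we quantify over canonical x, y equal to them).

{-# OPTIONS --safe #-}
-- Numbers are totally ordered and adding a game preserves ≰ as well as ≤.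
-- If the number B = [m,Δ] were not ≤ m, totality would give m ≤ B, whence
-- B + B ≤ m + m ≤ m + B while B ≰ m forbids B + B ≤ m + B; symmetrically for m ≤ B.
module Submission where

open import Defs
open import Data.Fin using (Fin; splitAt; _↑ˡ_; _↑ʳ_)
open import Data.Fin.Properties using (all?; ¬∀⟶∃¬; splitAt-↑ˡ; splitAt-↑ʳ)
open import Data.Sum using (_⊎_; inj₁; inj₂; [_,_])
open import Data.Product using (_,_; Σ; proj₁; proj₂)
open import Data.Empty using (⊥-elim)
open import Relation.Nullary using (¬_; Dec; yes; no)
open import Relation.Nullary.Decidable using (¬?; _×-dec_; decidable-stable)
open import Relation.Binary.PropositionalEquality using (subst)

≤G-intro : ∀ X Y → (∀ i → ¬ (Y ≤G leftOpt X i)) → (∀ j → ¬ (rightOpt Y j ≤G X)) → X ≤G Y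
≤G-intro (mk _ _ _ _) (mk _ _ _ _) noLeft noRight = noLeft , noRight

≤G⇒leftOpt≱ : ∀ X Y → X ≤G Y → ∀ i → ¬ (Y ≤G leftOpt X i)
≤G⇒leftOpt≱ (mk _ _ _ _) (mk _ _ _ _) = proj₁

≤G⇒rightOpt≰ : ∀ X Y → X ≤G Y → ∀ j → ¬ (rightOpt Y j ≤G X)
≤G⇒rightOpt≰ (mk _ _ _ _) (mk _ _ _ _) = proj₂

≤G-refl : ∀ X → X ≤G X
≤G-refl X@(mk _ L _ R) = ≤G-intro X X
  (λ i X≤Xᴸ → ≤G⇒leftOpt≱ X (L i) X≤Xᴸ i (≤G-refl (L i)))
  (λ j Xᴿ≤X → ≤G⇒rightOpt≰ (R j) X Xᴿ≤X j (≤G-refl (R j)))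

≤G-trans : ∀ G H K → G ≤G H → H ≤G K → G ≤G K
≤G-trans G@(mk _ L _ _) H K@(mk _ _ _ R) G≤H H≤K = ≤G-intro G K
  (λ i K≤Gᴸ → ≤G⇒leftOpt≱ G H G≤H i (≤G-trans H K (L i) H≤K K≤Gᴸ))
  (λ j Kᴿ≤G → ≤G⇒rightOpt≰ H K H≤K j (≤G-trans (R j) G H Kᴿ≤G G≤H))

leftOpt≱ : ∀ G i → ¬ (G ≤G leftOpt G i)
leftOpt≱ G = ≤G⇒leftOpt≱ G G (≤G-refl G)

rightOpt≰ : ∀ G j → ¬ (rightOpt G j ≤G G)
rightOpt≰ G = ≤G⇒rightOpt≰ G G (≤G-refl G)

_≤G?_ : ∀ G H → Dec (G ≤G H)
G@(mk _ L _ _) ≤G? H@(mk _ _ _ R) =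
  all? (λ i → ¬? (H ≤G? L i)) ×-dec all? (λ j → ¬? (R j ≤G? G))

≤G-stable : ∀ G H → ¬ ¬ (G ≤G H) → G ≤G H
≤G-stable G H = decidable-stable (G ≤G? H)

≰G-cases : ∀ G H → ¬ (G ≤G H) →
  (Σ (Fin (nL G)) λ i → H ≤G leftOpt G i) ⊎ (Σ (Fin (nR H)) λ j → rightOpt H j ≤G G)
≰G-cases G@(mk nl L _ _) H@(mk _ _ mr R) G≰H with all? (λ i → ¬? (H ≤G? L i))
... | no someLeft with ¬∀⟶∃¬ nl _ (λ i → ¬? (H ≤G? L i)) someLeft
...   | i , H≤Gᴸ = inj₁ (i , ≤G-stable H (L i) H≤Gᴸ)
≰G-cases G@(mk nl L _ _) H@(mk _ _ mr R) G≰H | yes noLeft with all? (λ j → ¬? (R j ≤G? G))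
... | yes noRight = ⊥-elim (G≰H (noLeft , noRight))
... | no someRight with ¬∀⟶∃¬ mr _ (λ j → ¬? (R j ≤G? G)) someRight
...   | j , Hᴿ≤G = inj₂ (j , ≤G-stable (R j) G Hᴿ≤G)

+G-leftOpt-elim : ∀ (P : Game → Set) G H →
  (∀ i → P (leftOpt G i +G H)) → (∀ j → P (G +G leftOpt H j)) →
  ∀ k → P (leftOpt (G +G H) k)
+G-leftOpt-elim P (mk nl _ _ _) (mk _ _ _ _) onG onH k with splitAt nl k
... | inj₁ i = onG i
... | inj₂ j = onH j

+G-rightOpt-elim : ∀ (P : Game → Set) G H →
  (∀ i → P (rightOpt G i +G H)) → (∀ j → P (G +G rightOpt H j)) →
  ∀ k → P (rightOpt (G +G H) k)
+G-rightOpt-elim P (mk _ _ nr _) (mk _ _ _ _) onG onH k with splitAt nr k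
... | inj₁ i = onG i
... | inj₂ j = onH j

+G-leftOptˡ≱ : ∀ G H i → ¬ ((G +G H) ≤G (leftOpt G i +G H))
+G-leftOptˡ≱ G@(mk nl L _ _) H@(mk ml L' _ _) i =
  subst (λ k → ¬ ((G +G H) ≤G [ (λ a → L a +G H) , (λ b → G +G L' b) ] k))
    (splitAt-↑ˡ nl i ml) (leftOpt≱ (G +G H) (i ↑ˡ ml))

+G-leftOptʳ≱ : ∀ G H j → ¬ ((G +G H) ≤G (G +G leftOpt H j))
+G-leftOptʳ≱ G@(mk nl L _ _) H@(mk ml L' _ _) j =
  subst (λ k → ¬ ((G +G H) ≤G [ (λ a → L a +G H) , (λ b → G +G L' b) ] k))
    (splitAt-↑ʳ nl ml j) (leftOpt≱ (G +G H) (nl ↑ʳ j))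

+G-rightOptˡ≰ : ∀ G H i → ¬ ((rightOpt G i +G H) ≤G (G +G H))
+G-rightOptˡ≰ G@(mk _ _ nr R) H@(mk _ _ mr R') i =
  subst (λ k → ¬ ([ (λ a → R a +G H) , (λ b → G +G R' b) ] k ≤G (G +G H)))
    (splitAt-↑ˡ nr i mr) (rightOpt≰ (G +G H) (i ↑ˡ mr))

+G-rightOptʳ≰ : ∀ G H j → ¬ ((G +G rightOpt H j) ≤G (G +G H))
+G-rightOptʳ≰ G@(mk _ _ nr R) H@(mk _ _ mr R') j =
  subst (λ k → ¬ ([ (λ a → R a +G H) , (λ b → G +G R' b) ] k ≤G (G +G H)))
    (splitAt-↑ʳ nr mr j) (rightOpt≰ (G +G H) (nr ↑ʳ j))

mutual
  +G-monoˡ-≤G : ∀ G H K → G ≤G H → (G +G K) ≤G (H +G K)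
  +G-monoˡ-≤G G@(mk _ L _ _) H@(mk _ _ _ R) K@(mk _ L' _ R') G≤H = ≤G-intro (G +G K) (H +G K)
    (+G-leftOpt-elim (λ Z → ¬ ((H +G K) ≤G Z)) G K
      (λ i → +G-monoˡ-≰G H (L i) K (≤G⇒leftOpt≱ G H G≤H i))
      (λ j H+K≤G+Kᴸ → +G-leftOptʳ≱ H K j
        (≤G-trans (H +G K) (G +G L' j) (H +G L' j) H+K≤G+Kᴸ (+G-monoˡ-≤G G H (L' j) G≤H))))
    (+G-rightOpt-elim (λ Z → ¬ (Z ≤G (G +G K))) H K
      (λ i → +G-monoˡ-≰G (R i) G K (≤G⇒rightOpt≰ G H G≤H i))
      (λ j H+Kᴿ≤G+K → +G-rightOptʳ≰ G K j
        (≤G-trans (G +G R' j) (H +G R' j) (G +G K) (+G-monoˡ-≤G G H (R' j) G≤H) H+Kᴿ≤G+K)))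

  -- The case split uses [_,_] and projections rather than with or a pattern
  -- lambda: those are lifted to auxiliary functions and hide the descent on G, H.
  +G-monoˡ-≰G : ∀ G H K → ¬ (G ≤G H) → ¬ ((G +G K) ≤G (H +G K))
  +G-monoˡ-≰G G@(mk _ L _ _) H@(mk _ _ _ R) K@(mk _ _ _ _) G≰H G+K≤H+K =
    [ (λ w → +G-leftOptˡ≱ G K (proj₁ w) (≤G-trans (G +G K) (H +G K) (L (proj₁ w) +G K)
               G+K≤H+K (+G-monoˡ-≤G H (L (proj₁ w)) K (proj₂ w))))
    , (λ w → +G-rightOptˡ≰ H K (proj₁ w) (≤G-trans (R (proj₁ w) +G K) (G +G K) (H +G K)
               (+G-monoˡ-≤G (R (proj₁ w)) G K (proj₂ w)) G+K≤H+K))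
    ] (≰G-cases G H G≰H)

mutual
  +G-monoʳ-≤G : ∀ G H K → G ≤G H → (K +G G) ≤G (K +G H)
  +G-monoʳ-≤G G@(mk _ L _ _) H@(mk _ _ _ R) K@(mk _ L' _ R') G≤H = ≤G-intro (K +G G) (K +G H)
    (+G-leftOpt-elim (λ Z → ¬ ((K +G H) ≤G Z)) K G
      (λ j K+H≤Kᴸ+G → +G-leftOptˡ≱ K H j
        (≤G-trans (K +G H) (L' j +G G) (L' j +G H) K+H≤Kᴸ+G (+G-monoʳ-≤G G H (L' j) G≤H)))
      (λ i → +G-monoʳ-≰G H (L i) K (≤G⇒leftOpt≱ G H G≤H i)))
    (+G-rightOpt-elim (λ Z → ¬ (Z ≤G (K +G G))) K H
      (λ j Kᴿ+H≤K+G → +G-rightOptˡ≰ K G j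
        (≤G-trans (R' j +G G) (R' j +G H) (K +G G) (+G-monoʳ-≤G G H (R' j) G≤H) Kᴿ+H≤K+G))
      (λ i → +G-monoʳ-≰G (R i) G K (≤G⇒rightOpt≰ G H G≤H i)))

  +G-monoʳ-≰G : ∀ G H K → ¬ (G ≤G H) → ¬ ((K +G G) ≤G (K +G H))
  +G-monoʳ-≰G G@(mk _ L _ _) H@(mk _ _ _ R) K@(mk _ _ _ _) G≰H K+G≤K+H =
    [ (λ w → +G-leftOptʳ≱ K G (proj₁ w) (≤G-trans (K +G G) (K +G H) (K +G L (proj₁ w))
               K+G≤K+H (+G-monoʳ-≤G H (L (proj₁ w)) K (proj₂ w))))
    , (λ w → +G-rightOptʳ≰ K H (proj₁ w) (≤G-trans (K +G R (proj₁ w)) (K +G G) (K +G H)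
               (+G-monoʳ-≤G (R (proj₁ w)) G K (proj₂ w)) K+G≤K+H))
    ] (≰G-cases G H G≰H)

mutual
  number-leftOpt≤G : ∀ G → IsNumber G → ∀ i → leftOpt G i ≤G G
  number-leftOpt≤G G@(mk _ L _ _) (numL , _ , L<R) i = ≤G-intro (L i) G
    (λ k G≤Gᴸᴸ → leftOpt≱ G i
      (≤G-trans G (leftOpt (L i) k) (L i) G≤Gᴸᴸ (number-leftOpt≤G (L i) (numL i) k)))
    (λ j Gᴿ≤Gᴸ → proj₂ (L<R i j) Gᴿ≤Gᴸ)

  number-≤G-rightOpt : ∀ G → IsNumber G → ∀ j → G ≤G rightOpt G j
  number-≤G-rightOpt G@(mk _ _ _ R) (_ , numR , L<R) j = ≤G-intro G (R j)
    (λ i Gᴿ≤Gᴸ → proj₂ (L<R i j) Gᴿ≤Gᴸ)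
    (λ k Gᴿᴿ≤G → rightOpt≰ G j
      (≤G-trans (R j) (rightOpt (R j) k) G (number-≤G-rightOpt (R j) (numR j) k) Gᴿᴿ≤G))

number-≤G-total : ∀ G H → IsNumber G → IsNumber H → ¬ (G ≤G H) → H ≤G G
number-≤G-total G H numG numH G≰H with ≰G-cases G H G≰H
... | inj₁ (i , H≤Gᴸ) = ≤G-trans H (leftOpt G i) G H≤Gᴸ (number-leftOpt≤G G numG i)
... | inj₂ (j , Hᴿ≤G) = ≤G-trans H (rightOpt H j) G (number-≤G-rightOpt H numH j) Hᴿ≤G

number-double-cancel-≤G : ∀ G H → IsNumber G → IsNumber H → (G +G G) ≤G (H +G H) → G ≤G H
number-double-cancel-≤G G H numG numH G+G≤H+H = ≤G-stable G H λ G≰H →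
  let H≤G = number-≤G-total G H numG numH G≰H
  in +G-monoˡ-≰G G H G G≰H
       (≤G-trans (G +G G) (H +G H) (H +G G) G+G≤H+H (+G-monoʳ-≤G H G H H≤G))

lemma2p9 : (m Δ x y : Game) →
    IsNumber m → IsNumber Δ → Δ <G 0G →
    IsCanonical x → x ≈G (m +G Δ) →
    IsCanonical y → y ≈G (m -G Δ) →
    IsNumber ⟨ x ∣ y ⟩ →
    (⟨ x ∣ y ⟩ +G ⟨ x ∣ y ⟩) ≈G (m +G m) →
    ⟨ x ∣ y ⟩ ≈G m
lemma2p9 m _ x y numm _ _ _ _ _ _ numB (B+B≤m+m , m+m≤B+B) =
  number-double-cancel-≤G ⟨ x ∣ y ⟩ m numB numm B+B≤m+m ,
  number-double-cancel-≤G m ⟨ x ∣ y ⟩ numm numB m+m≤B+B
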